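{- For every integer $N>2$ and every partition vector $p\in PV_N$, there exist natural numbers $\Omega=(\alpha_1,\dots,\alpha_N)$ with $1\le\alpha_i<2^N$ for all $i$ such that $\langle p,\Omega\rangle=0$, and $p$ is the unique partition vector in $PV_N$ with this property, i.e. $\langle p',\Omega\rangle\ne 0$ for every $p'\in PV_N$ with $p'\neq p$.
   Context: A partition vector of length $N$ is $p=(p_1,\dots,p_N)\in\{1,-1\}^N$. Following the paper's convention ($p$ and $-p$ describe the same partition, and the all-ones vector describes no partition), $PV_N$ denotes the set of partition vectors with $p_1=1$ other than the all-ones vector. For $\Omega=(\alpha_1,\dots,\alpha_N)$, $\langle p,\Omega\rangle=\sum_{i=1}^N p_i\alpha_i$. -}

module Defs where

open import Data.Nat using (ℕ; suc; _≤_; _<_; _^_)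
open import Data.Integer using (ℤ; +_; -_; _+_)
open import Data.Fin using (Fin; zero; suc)
open import Data.Product using (Σ; _×_; ∃)
open import Relation.Binary.PropositionalEquality using (_≡_)

data Sign : Set where
  plus minus : Sign

act : Sign → ℕ → ℤ
act plus  a = + a
act minus a = - (+ a)

SignVec : ℕ → Set
SignVec N = Fin N → Sign

inner : (N : ℕ) → SignVec N → (Fin N → ℕ) → ℤ
inner ℕ.zero    p Ω = + 0
inner (suc N) p Ω = act (p zero) (Ω zero) + inner N (λ i → p (suc i)) (λ i → Ω (suc i))

-- PV_N : p₁ = 1 and p is not the all-ones vector (some entry is -1)
-- (for N ≥ 1; first index is Fin.zero)
IsPV : (N : ℕ) → SignVec (suc N) → Set
IsPV N p = (p zero ≡ plus) × ∃ (λ (i : Fin (suc N)) → p i ≡ minus)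

-- Weights 2^(N-1), …, 2, 1 are superincreasing, so a signed sum of them determines
-- every sign. Given p with p_k = -1, set the k-th weight to 0: the first weight still
-- dominates, hence c = ⟨p, w⁰⟩ > 0, and putting c back at position k gives Ω with
-- ⟨p, Ω⟩ = c - c = 0. If also ⟨p', Ω⟩ = 0 and p'_1 = 1, then ⟨p', w⁰⟩ = ±c. The value
-- -c = ⟨-p, w⁰⟩ would force p'_1 = -p_1 = -1, so p'_k = -1 and ⟨p', w⁰⟩ = ⟨p, w⁰⟩,
-- which forces p' = p away from k.
module Submission where

open import Algebra.Bundles using (AbelianGroup)
open import Data.Empty using (⊥-elim)
open import Data.Fin using (Fin; zero; suc; _≟_)
open import Data.Integer as ℤ using (ℤ; +_; -_; _+_; ∣_∣; +<+)
import Data.Integer.Properties as ℤᵖ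
open import Data.Nat as ℕ using (ℕ; suc; _≤_; _<_; _^_)
import Data.Nat.Properties as ℕᵖ
open import Data.Product using (Σ; _×_; _,_; proj₁; map₂)
open import Data.Unit using (⊤)
open import Data.Vec.Functional using (Vector; tail; foldr; updateAt)
open import Data.Vec.Functional.Properties using (updateAt-minimal)
open import Function using (_∘_; const)
open import Relation.Binary.PropositionalEquality
open import Relation.Nullary using (yes; no; contradiction)

open import Defs

open import Algebra.Properties.Group (AbelianGroup.group ℤᵖ.+-0-abelianGroup)
  using (∙-cancelˡ)

sum : ∀ {n} → Vector ℕ n → ℕ
sum = foldr ℕ._+_ 0

lookup≤sum : ∀ {n} (w : Vector ℕ n) i → w i ≤ sum w
lookup≤sum w zero    = ℕᵖ.m≤m+n (w zero) (sum (tail w))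
lookup≤sum w (suc i) = ℕᵖ.≤-trans (lookup≤sum (tail w) i) (ℕᵖ.m≤n+m _ (w zero))

sum-updateAt-0 : ∀ {n} (w : Vector ℕ n) k → sum (updateAt w k (const 0)) ≤ sum w
sum-updateAt-0 w zero    = ℕᵖ.m≤n+m _ (w zero)
sum-updateAt-0 w (suc k) = ℕᵖ.+-monoʳ-≤ (w zero) (sum-updateAt-0 (tail w) k)

updateAt-const-preserves : ∀ {n} {A : Set} (P : A → Set) (w : Vector A n) k {a} →
  P a → (∀ i → P (w i)) → ∀ i → P (updateAt w k (const a) i)
updateAt-const-preserves P w zero    Pa Pw zero    = Pa
updateAt-const-preserves P w zero    Pa Pw (suc i) = Pw (suc i)
updateAt-const-preserves P w (suc k) Pa Pw zero    = Pw zero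
updateAt-const-preserves P w (suc k) Pa Pw (suc i) =
  updateAt-const-preserves P (tail w) k Pa (Pw ∘ suc) i

Superincreasing : ∀ {n} → Vector ℕ n → Set
Superincreasing {ℕ.zero} w = ⊤
Superincreasing {suc n}  w = (w zero ≢ 0 → sum (tail w) < w zero) × Superincreasing (tail w)

superincreasing-updateAt-0 : ∀ {n} (w : Vector ℕ n) k →
  Superincreasing w → Superincreasing (updateAt w k (const 0))
superincreasing-updateAt-0 w zero    (_ , super)   = (λ 0≢0 → contradiction refl 0≢0) , super
superincreasing-updateAt-0 w (suc k) (dom , super) =
  (λ w₀≢0 → ℕᵖ.≤-<-trans (sum-updateAt-0 (tail w) k) (dom w₀≢0)) ,
  superincreasing-updateAt-0 (tail w) k super

powers : ∀ n → Vector ℕ n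
powers (suc n) zero    = 2 ^ n
powers (suc n) (suc i) = powers n i

suc-sum-powers : ∀ n → suc (sum (powers n)) ≡ 2 ^ n
suc-sum-powers ℕ.zero  = refl
suc-sum-powers (suc n) = begin
  suc (2 ^ n ℕ.+ sum (powers n)) ≡⟨ ℕᵖ.+-suc (2 ^ n) _ ⟨
  2 ^ n ℕ.+ suc (sum (powers n)) ≡⟨ cong (2 ^ n ℕ.+_) (suc-sum-powers n) ⟩
  2 ^ n ℕ.+ 2 ^ n                ≡⟨ cong (2 ^ n ℕ.+_) (ℕᵖ.+-identityʳ (2 ^ n)) ⟨
  2 ^ suc n                      ∎
  where open ≡-Reasoning

sum-powers<2^ : ∀ n → sum (powers n) < 2 ^ n
sum-powers<2^ n = ℕᵖ.≤-reflexive (suc-sum-powers n)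

powers-positive : ∀ n i → 1 ≤ powers n i
powers-positive (suc n) zero    = ℕᵖ.m^n>0 2 n
powers-positive (suc n) (suc i) = powers-positive n i

powers-superincreasing : ∀ n → Superincreasing (powers n)
powers-superincreasing ℕ.zero  = _
powers-superincreasing (suc n) = (λ _ → sum-powers<2^ n) , powers-superincreasing n

neg : Sign → Sign
neg plus  = minus
neg minus = plus

plus≢minus : plus ≢ minus
plus≢minus ()

act-zero : ∀ s → act s 0 ≡ + 0
act-zero plus  = refl
act-zero minus = refl

act-neg : ∀ s a → act (neg s) a ≡ - act s a
act-neg plus  a = refl
act-neg minus a = sym (ℤᵖ.neg-involutive (+ a))

neg-act-neg : ∀ s a → - act (neg s) a ≡ act s a
neg-act-neg s a = trans (cong -_ (act-neg s a)) (ℤᵖ.neg-involutive (act s a))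

act≤ : ∀ s a → act s a ℤ.≤ + a
act≤ plus  a = ℤᵖ.≤-refl
act≤ minus a = ℤᵖ.neg-≤-pos

+act≡0⇒≡act-neg : ∀ {x} s a → x + act s a ≡ + 0 → x ≡ act (neg s) a
+act≡0⇒≡act-neg {x} s a eq = ℤᵖ.i-j≡0⇒i≡j x _ (trans (cong (_+_ x) (neg-act-neg s a)) eq)

inner-neg : ∀ {n} (s : SignVec n) w → inner n (neg ∘ s) w ≡ - inner n s w
inner-neg {ℕ.zero} s w = refl
inner-neg {suc n}  s w = begin
  act (neg (s zero)) (w zero) + inner n (neg ∘ tail s) (tail w)
    ≡⟨ cong₂ _+_ (act-neg (s zero) (w zero)) (inner-neg (tail s) (tail w)) ⟩
  - act (s zero) (w zero) + - inner n (tail s) (tail w)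
    ≡⟨ ℤᵖ.neg-distrib-+ (act (s zero) (w zero)) _ ⟨
  - (act (s zero) (w zero) + inner n (tail s) (tail w)) ∎
  where open ≡-Reasoning

inner≤sum : ∀ {n} (s : SignVec n) w → inner n s w ℤ.≤ + sum w
inner≤sum {ℕ.zero} s w = ℤᵖ.≤-refl
inner≤sum {suc n}  s w = ℤᵖ.+-mono-≤ (act≤ (s zero) (w zero)) (inner≤sum (tail s) (tail w))

-sum≤inner : ∀ {n} (s : SignVec n) w → - + sum w ℤ.≤ inner n s w
-sum≤inner {n} s w = subst (- + sum w ℤ.≤_) (ℤᵖ.neg-involutive (inner n s w))
  (ℤᵖ.neg-mono-≤ (subst (ℤ._≤ + sum w) (inner-neg s w) (inner≤sum (neg ∘ s) w)))

inner-pos : ∀ {n} (s : SignVec (suc n)) w → s zero ≡ plus →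
  sum (tail w) < w zero → + 0 ℤ.< inner (suc n) s w
inner-pos {n} s w s₀ dominant rewrite s₀ = begin-strict
  + 0                                  <⟨ +<+ (ℕᵖ.m<n⇒0<n∸m dominant) ⟩
  + (w zero ℕ.∸ sum (tail w))          ≡⟨ difference ⟨
  + w zero + - + sum (tail w)          ≤⟨ ℤᵖ.+-monoʳ-≤ (+ w zero) (-sum≤inner (tail s) (tail w)) ⟩
  + w zero + inner n (tail s) (tail w) ∎
  where
  open ℤᵖ.≤-Reasoning
  difference : + w zero + - + sum (tail w) ≡ + (w zero ℕ.∸ sum (tail w))
  difference = trans (ℤᵖ.m-n≡m⊖n (w zero) (sum (tail w))) (ℤᵖ.⊖-≥ (ℕᵖ.<⇒≤ dominant))

inner-opposite-heads : ∀ {n} (s t : SignVec (suc n)) w → sum (tail w) < w zero →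
  s zero ≡ plus → t zero ≡ minus → inner (suc n) s w ≢ inner (suc n) t w
inner-opposite-heads {n} s t w dominant s₀ t₀ eq = ℤᵖ.<-asym (ℤᵖ.neg-mono-< t-pos) neg-t-pos
  where
  t-pos : + 0 ℤ.< inner (suc n) t w
  t-pos = subst (+ 0 ℤ.<_) eq (inner-pos s w s₀ dominant)
  neg-t-pos : + 0 ℤ.< - inner (suc n) t w
  neg-t-pos = subst (+ 0 ℤ.<_) (inner-neg t w) (inner-pos (neg ∘ t) w (cong neg t₀) dominant)

inner-head-determined : ∀ {n} (s t : SignVec (suc n)) w → sum (tail w) < w zero →
  inner (suc n) s w ≡ inner (suc n) t w → s zero ≡ t zero
inner-head-determined s t w dominant eq = signs-equal (s zero) (t zero) refl refl
  where
  signs-equal : ∀ σ τ → s zero ≡ σ → t zero ≡ τ → σ ≡ τ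
  signs-equal plus  plus  _  _  = refl
  signs-equal minus minus _  _  = refl
  signs-equal plus  minus s₀ t₀ = ⊥-elim (inner-opposite-heads s t w dominant s₀ t₀ eq)
  signs-equal minus plus  s₀ t₀ = ⊥-elim (inner-opposite-heads t s w dominant t₀ s₀ (sym eq))

superincreasing-inner-injective : ∀ {n} (w : Vector ℕ n) → Superincreasing w →
  (s t : SignVec n) → inner n s w ≡ inner n t w → ∀ i → w i ≢ 0 → s i ≡ t i
superincreasing-inner-injective w (dominant , _) s t eq zero w₀≢0 =
  inner-head-determined s t w (dominant w₀≢0) eq
superincreasing-inner-injective w (dominant , super) s t eq (suc i) wᵢ≢0 =
  superincreasing-inner-injective (tail w) super (tail s) (tail t) tails-equal i wᵢ≢0
  where
  heads-equal : act (s zero) (w zero) ≡ act (t zero) (w zero)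
  heads-equal with w zero ℕ.≟ 0
  ... | yes w₀≡0 rewrite w₀≡0 = trans (act-zero (s zero)) (sym (act-zero (t zero)))
  ... | no  w₀≢0 = cong (λ σ → act σ (w zero)) (inner-head-determined s t w (dominant w₀≢0) eq)
  tails-equal : inner _ (tail s) (tail w) ≡ inner _ (tail t) (tail w)
  tails-equal = ∙-cancelˡ (act (s zero) (w zero)) _ _ (trans eq (cong (_+ _) (sym heads-equal)))

inner-updateAt : ∀ {n} (q : SignVec n) w k a →
  inner n q (updateAt w k (const a)) ≡ inner n q (updateAt w k (const 0)) + act (q k) a
inner-updateAt {suc n} q w zero a = begin
  act (q zero) a + rest                ≡⟨ ℤᵖ.+-comm (act (q zero) a) rest ⟩
  rest + act (q zero) a                ≡⟨ cong (_+ act (q zero) a) (ℤᵖ.+-identityˡ rest) ⟨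
  + 0 + rest + act (q zero) a          ≡⟨ cong (λ x → x + rest + act (q zero) a) (act-zero (q zero)) ⟨
  act (q zero) 0 + rest + act (q zero) a ∎
  where
  open ≡-Reasoning
  rest : ℤ
  rest = inner n (tail q) (tail w)
inner-updateAt {suc n} q w (suc k) a = begin
  act (q zero) (w zero) + inner n (tail q) (updateAt (tail w) k (const a))
    ≡⟨ cong (_+_ (act (q zero) (w zero))) (inner-updateAt (tail q) (tail w) k a) ⟩
  act (q zero) (w zero) + (inner n (tail q) (updateAt (tail w) k (const 0)) + act (q (suc k)) a)
    ≡⟨ ℤᵖ.+-assoc (act (q zero) (w zero)) _ _ ⟨
  act (q zero) (w zero) + inner n (tail q) (updateAt (tail w) k (const 0)) + act (q (suc k)) a ∎
  where open ≡-Reasoning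

module Balancing {n} (w : Vector ℕ (suc n)) (w-positive : ∀ i → 1 ≤ w i)
  (w-super : Superincreasing w) (p : SignVec (suc n)) (p₀ : p zero ≡ plus)
  (k : Fin (suc n)) (pₖ : p k ≡ minus) where

  w⁰ : Vector ℕ (suc n)
  w⁰ = updateAt w k (const 0)

  w⁰-super : Superincreasing w⁰
  w⁰-super = superincreasing-updateAt-0 w k w-super

  w⁰ᵢ≢0 : ∀ {i} → i ≢ k → w⁰ i ≢ 0
  w⁰ᵢ≢0 {i} i≢k = subst (_≢ 0) (sym (updateAt-minimal i k w i≢k)) (ℕᵖ.n>0⇒n≢0 (w-positive i))

  w⁰-dominant : sum (tail w⁰) < w⁰ zero
  w⁰-dominant = proj₁ w⁰-super (w⁰ᵢ≢0 0≢k)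
    where
    0≢k : zero ≢ k
    0≢k 0≡k = plus≢minus (trans (sym p₀) (trans (cong p 0≡k) pₖ))

  c : ℕ
  c = ∣ inner (suc n) p w⁰ ∣

  inner-p-w⁰-pos : + 0 ℤ.< inner (suc n) p w⁰
  inner-p-w⁰-pos = inner-pos p w⁰ p₀ w⁰-dominant

  +c≡inner-p-w⁰ : + c ≡ inner (suc n) p w⁰
  +c≡inner-p-w⁰ = ℤᵖ.0≤i⇒+∣i∣≡i (ℤᵖ.<⇒≤ inner-p-w⁰-pos)

  c-positive : 1 ≤ c
  c-positive = ℤᵖ.drop‿+<+ (subst (+ 0 ℤ.<_) (sym +c≡inner-p-w⁰) inner-p-w⁰-pos)

  c≤sum : c ≤ sum w
  c≤sum = ℕᵖ.≤-trans
    (ℤᵖ.drop‿+≤+ (subst (ℤ._≤ + sum w⁰) (sym +c≡inner-p-w⁰) (inner≤sum p w⁰)))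
    (sum-updateAt-0 w k)

  Ω : Vector ℕ (suc n)
  Ω = updateAt w k (const c)

  Ω-bounds : ∀ i → 1 ≤ Ω i × Ω i ≤ sum w
  Ω-bounds = updateAt-const-preserves (λ x → 1 ≤ x × x ≤ sum w) w k
    (c-positive , c≤sum) (λ i → w-positive i , lookup≤sum w i)

  p-balances-Ω : inner (suc n) p Ω ≡ + 0
  p-balances-Ω = begin
    inner (suc n) p Ω                ≡⟨ inner-updateAt p w k c ⟩
    inner (suc n) p w⁰ + act (p k) c ≡⟨ cong₂ _+_ (sym +c≡inner-p-w⁰) (cong (λ σ → act σ c) pₖ) ⟩
    + c + - + c                      ≡⟨ ℤᵖ.+-inverseʳ (+ c) ⟩
    + 0                              ∎
    where open ≡-Reasoning

  balancing-sign : ∀ p' → p' zero ≡ plus → inner (suc n) p' w⁰ ≡ act (neg (p' k)) c → p' k ≡ minus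
  balancing-sign p' p'₀ eq with p' k
  ... | minus = refl
  ... | plus  = ⊥-elim (plus≢minus (trans (sym p'₀) (trans p'₀≡-p₀ (cong neg p₀))))
    where
    p'₀≡-p₀ : p' zero ≡ neg (p zero)
    p'₀≡-p₀ = inner-head-determined p' (neg ∘ p) w⁰ w⁰-dominant
      (trans eq (trans (cong -_ +c≡inner-p-w⁰) (sym (inner-neg p w⁰))))

  only-p-balances-Ω : ∀ p' → p' zero ≡ plus → inner (suc n) p' Ω ≡ + 0 → ∀ i → p' i ≡ p i
  only-p-balances-Ω p' p'₀ balanced = agree
    where
    eq : inner (suc n) p' w⁰ ≡ act (neg (p' k)) c
    eq = +act≡0⇒≡act-neg (p' k) c (trans (sym (inner-updateAt p' w k c)) balanced)
    p'ₖ : p' k ≡ minus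
    p'ₖ = balancing-sign p' p'₀ eq
    same-inner : inner (suc n) p' w⁰ ≡ inner (suc n) p w⁰
    same-inner = trans eq (trans (cong (λ σ → act (neg σ) c) p'ₖ) +c≡inner-p-w⁰)
    agree : ∀ i → p' i ≡ p i
    agree i with i ≟ k
    ... | yes refl = trans p'ₖ (sym pₖ)
    ... | no  i≢k  = superincreasing-inner-injective w⁰ w⁰-super p' p same-inner i (w⁰ᵢ≢0 i≢k)

lemma2p1 : (M : ℕ) → 2 < suc M → (p : SignVec (suc M)) → IsPV M p →
    Σ (Fin (suc M) → ℕ) (λ Ω →
      ((i : Fin (suc M)) → (1 ≤ Ω i) × (Ω i < 2 ^ suc M)) ×
      (inner (suc M) p Ω ≡ + 0) ×
      ((p' : SignVec (suc M)) → IsPV M p' → inner (suc M) p' Ω ≡ + 0 → (i : Fin (suc M)) → p' i ≡ p i))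
lemma2p1 M _ p (p₀ , k , pₖ) =
  Ω , bounds , p-balances-Ω , λ p' (p'₀ , _) → only-p-balances-Ω p' p'₀
  where
  open Balancing (powers (suc M)) (powers-positive (suc M)) (powers-superincreasing (suc M)) p p₀ k pₖ
  bounds : ∀ i → 1 ≤ Ω i × Ω i < 2 ^ suc M
  bounds i = map₂ (λ Ωᵢ≤sum → ℕᵖ.≤-<-trans Ωᵢ≤sum (sum-powers<2^ (suc M))) (Ω-bounds i)
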